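{- Let $p>3$ be a prime, $t\in \{1,3,p,3p\}$, and $1\leqslant r\leqslant 3p-1$ with $\gcd(r,3p)=1$. Then \[ \mathsf{c}(U_{3p}, a_{3p,r,0})= \begin{cases} 2+\frac{3(p-1)}{|r|_p} & \text{if } r\equiv 1\pmod 3,\\ 1+\frac{2(p-1)}{|r|_p} & \text{if } r\equiv 2\pmod 3\text{ and $|r|_p$ is odd}, \\ 1+\frac{3(p-1)}{|r|_p} & \text{if } r\equiv 2\pmod 3\text{ and $|r|_p$ is even}. \end{cases} \]
   Context: $|r|_p$ is the multiplicative order of $r$ modulo $p$. $\mathrm{D}_{6p}=\langle u_{3p},v_{3p}\mid u_{3p}^{3p}=v_{3p}^2=1,\ v_{3p}u_{3p}v_{3p}=u_{3p}^{ -1}\rangle$; $a_{3p,r,0}$ is the automorphism $u_{3p}^i\mapsto u_{3p}^{ri}$, $u_{3p}^jv_{3p}\mapsto u_{3p}^{rj}v_{3p}$. $U_{3p}=\langle u_{3p}\rangle\setminus\{1\}$. $\mathsf{c}(U_{3p},a)$ is the number of cycles (including fixed points) of $a$ on $U_{3p}$. -}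

module Defs where

open import Data.Nat.Base
open import Data.Bool.Base using (Bool; true; false; if_then_else_)
open import Data.List.Base using (List; map; upTo)
open import Data.Bool.ListAction using (and)
open import Data.Nat.ListAction using (sum)
open import Data.Product.Base using (_×_)
open import Relation.Binary.PropositionalEquality using (_≡_)

-- x mod n (with the irrelevant convention x mod 0 = x, never used below
-- since all moduli here are positive)
modN : ℕ → ℕ → ℕ
modN zero    x = x
modN (suc m) x = x % suc m

IsMultOrder : (p r k : ℕ) → Set
IsMultOrder p r k =
  0 < k × modN p (r ^ k) ≡ modN p 1 ×
  (∀ j → 0 < j → modN p (r ^ j) ≡ modN p 1 → k ≤ j)

-- the automorphism a_{n,r,0} restricted to <u_n>, written on exponents:
-- u_n^i ↦ u_n^{r i}, i.e. i ↦ r i mod n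
aExp : (n r : ℕ) → ℕ → ℕ
aExp n r i = modN n (r * i)

iter : (ℕ → ℕ) → ℕ → ℕ → ℕ
iter f zero    x = x
iter f (suc k) x = f (iter f k x)

-- the cycle of a_{n,r,0} through u_n^i, as exponents f^k(i), 0 ≤ k < n
-- (every cycle on the n-element set <u_n> has length ≤ n, so this is the whole cycle)
cycleOf : (n r i : ℕ) → List ℕ
cycleOf n r i = map (λ k → iter (aExp n r) k i) (upTo n)

isCycleRep : (n r i : ℕ) → Bool
isCycleRep n r i = and (map (λ j → i ≤ᵇ j) (cycleOf n r i))

-- U_n = <u_n> \ {1} = { u_n^i : 1 ≤ i ≤ n-1 }
UExp : ℕ → List ℕ
UExp n = map suc (upTo (n ∸ 1))

-- c(U_n, a_{n,r,0}) : number of cycles (incl. fixed points) of a_{n,r,0} on U_n,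
-- counted as the number of cycles, each counted once via its least exponent
cU : (n r : ℕ) → ℕ
cU n r = sum (map (λ i → if isCycleRep n r i then 1 else 0) (UExp n))

{-# OPTIONS --safe #-}
module Submission where

-- On exponents, a_{3p,r,0} is i ↦ r i mod 3p. It preserves the order of u^i, so U_{3p} splits
-- into the p − 1 elements of order p (3 ∣ i, p ∤ i), the 2 of order 3 (p ∣ i, 3 ∤ i) and the
-- 2(p − 1) of order 3p. As a^m fixes u^i iff 3p ∣ (r^m − 1) i, every cycle inside one class has
-- the same length: k = |r|_p, ℓ = |r|_3 ∈ {1, 2} and lcm(ℓ, k) respectively. Double counting
-- (cycle, point) pairs in each class gives c = (p − 1)/k + 2/ℓ + 2(p − 1)/lcm(ℓ, k), and the
-- three cases of the statement are (ℓ, lcm) = (1, k), (2, 2k) for k odd and (2, k) for k even.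

open import Defs

open import Data.Bool.Base using (Bool; true; false; if_then_else_; T; _∧_; not)
open import Data.Bool.ListAction using (and)
open import Data.Bool.Properties using (T-∧)
open import Data.Fin.Base using (Fin; toℕ; fromℕ<)
open import Data.Fin.Properties using (toℕ<n; toℕ-fromℕ<; pigeonhole)
import Data.List.Base as List
open import Data.List.Base using (applyUpTo; upTo; []; _∷_)
open import Data.List.Extrema.Nat using (argmin; f[argmin]≤f[xs])
open import Data.List.Membership.Propositional.Properties using (∈-upTo⁺; ∈-upTo⁻)
open import Data.List.Properties using (map-applyUpTo)
import Data.List.Relation.Unary.All as All
open import Data.List.Relation.Unary.All using (All; []; _∷_)
open import Data.List.Relation.Unary.All.Properties using (map⁺; map⁻)
open import Data.Nat.Base
open import Data.Nat.Coprimality using (Coprime)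
open import Data.Nat.Divisibility
open import Data.Nat.DivMod
open import Data.Nat.ListAction using (sum)
open import Data.Nat.Primality using (Prime; euclidsLemma; prime?; prime[2]; prime⇒nonZero)
open import Data.Nat.Properties
open import Data.Nat.Tactic.RingSolver using (solve-∀)
open import Data.Product.Base using (_×_; _,_; proj₁; proj₂; ∃-syntax)
open import Data.Product.Function.NonDependent.Propositional using (_×-⇔_)
open import Data.Sum.Base using (_⊎_; inj₁; inj₂; [_,_]; [_,_]′)
open import Data.Sum.Function.Propositional using (_⊎-⇔_)
open import Data.Unit.Base using (tt)
open import Function.Base using (_∘_; id)
open import Function.Bundles using (_⇔_; mk⇔; Equivalence)
open import Function.Construct.Composition using (_⇔-∘_)
open import Function.Construct.Identity using (⇔-id)
open import Function.Construct.Symmetry using (⇔-sym)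
open import Relation.Binary.Definitions using (tri<; tri≈; tri>)
open import Relation.Binary.PropositionalEquality
  using (_≡_; _≢_; refl; sym; trans; cong; cong₂; subst; module ≡-Reasoning)
open import Relation.Nullary.Decidable
  using (Dec; yes; no; ⌊_⌋; isYes≗does; does-⇔; toWitness; fromWitness; toWitnessFalse; fromWitnessFalse; from-yes)
open import Relation.Nullary.Negation using (¬_; contradiction)

open import Algebra.Properties.Semiring.Sum +-*-semiring
  using (sum-syntax; sum-cong-≗; sum-replicate-zero; ∑-distrib-+; ∑-comm; *-distribʳ-sum)

𝟙 : Bool → ℕ
𝟙 b = if b then 1 else 0

𝟙-true : ∀ {b} → T b → 𝟙 b ≡ 1
𝟙-true {true} _ = refl

𝟙-false : ∀ {b} → ¬ T b → 𝟙 b ≡ 0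
𝟙-false {true}  ¬b = contradiction _ ¬b
𝟙-false {false} _  = refl

𝟙-split : ∀ a b → 𝟙 a ≡ 𝟙 (a ∧ not b) + 𝟙 (a ∧ b)
𝟙-split false _     = refl
𝟙-split true  false = refl
𝟙-split true  true  = refl

𝟙-splitʳ : ∀ a b → 𝟙 b ≡ 𝟙 (not a ∧ b) + 𝟙 (a ∧ b)
𝟙-splitʳ false false = refl
𝟙-splitʳ false true  = refl
𝟙-splitʳ true  false = refl
𝟙-splitʳ true  true  = refl

𝟙-not : ∀ a → 1 ≡ 𝟙 a + 𝟙 (not a)
𝟙-not false = refl
𝟙-not true  = refl

𝟙-cover : ∀ a b c → 𝟙 (not (a ∧ b) ∧ c) ≡ 𝟙 ((a ∧ not b) ∧ c) + 𝟙 ((not a ∧ b) ∧ c) + 𝟙 ((not a ∧ not b) ∧ c)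
𝟙-cover false false _     = refl
𝟙-cover false true  false = refl
𝟙-cover false true  true  = refl
𝟙-cover true  false false = refl
𝟙-cover true  false true  = refl
𝟙-cover true  true  _     = refl

𝟙-not-false : ∀ {b} c → ¬ T b → 𝟙 (not b ∧ c) ≡ 𝟙 c
𝟙-not-false {false} c _  = refl
𝟙-not-false {true}  c ¬b = contradiction _ ¬b

𝟙-not-true : ∀ {b} c → T b → 𝟙 (not b ∧ c) ≡ 0
𝟙-not-true {true} c _ = refl

T-and : ∀ bs → T (and bs) ⇔ All T bs
T-and []       = mk⇔ (λ _ → []) (λ _ → tt)
T-and (b ∷ bs) = mk⇔
  (λ t → let tb , tbs = Equivalence.to T-∧ t in tb ∷ Equivalence.to (T-and bs) tbs)
  (λ { (tb ∷ tbs) → Equivalence.from T-∧ (tb , Equivalence.from (T-and bs) tbs) })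

T⌊⌋⇔ : ∀ {a} {A : Set a} (a? : Dec A) → T ⌊ a? ⌋ ⇔ A
T⌊⌋⇔ a? = mk⇔ (toWitness {a? = a?}) (fromWitness {a? = a?})

T-not⌊⌋⇔ : ∀ {a} {A : Set a} (a? : Dec A) → T (not ⌊ a? ⌋) ⇔ (¬ A)
T-not⌊⌋⇔ a? = mk⇔ (toWitnessFalse {a? = a?}) (fromWitnessFalse {a? = a?})

⌊⌋-cong : ∀ {a b} {A : Set a} {B : Set b} → A ⇔ B → (a? : Dec A) (b? : Dec B) → ⌊ a? ⌋ ≡ ⌊ b? ⌋
⌊⌋-cong A⇔B a? b? = trans (isYes≗does a?) (trans (does-⇔ A⇔B a? b?) (sym (isYes≗does b?)))

∑-cong< : ∀ n (g h : ℕ → ℕ) → (∀ i → i < n → g i ≡ h i) →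
          ∑[ i < n ] g (toℕ i) ≡ ∑[ i < n ] h (toℕ i)
∑-cong< n g h g≡h = sum-cong-≗ (λ i → g≡h (toℕ i) (toℕ<n i))

∑-zero : ∀ n (g : ℕ → ℕ) → (∀ i → i < n → g i ≡ 0) → ∑[ i < n ] g (toℕ i) ≡ 0
∑-zero n g g≡0 = trans (∑-cong< n g (λ _ → 0) g≡0) (sum-replicate-zero n)

∑-one : ∀ n → ∑[ i < n ] 1 ≡ n
∑-one zero    = refl
∑-one (suc n) = cong suc (∑-one n)

∑-single : ∀ n (g : ℕ → ℕ) {a} → a < n → (∀ i → i < n → i ≢ a → g i ≡ 0) →
           ∑[ i < n ] g (toℕ i) ≡ g a
∑-single (suc n) g {zero} _ g≡0 =
  trans (cong (g 0 +_) (∑-zero n (g ∘ suc) (λ i i<n → g≡0 (suc i) (s<s i<n) λ ())))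
        (+-identityʳ (g 0))
∑-single (suc n) g {suc a} (s<s a<n) g≡0 =
  trans (cong (_+ ∑[ i < n ] g (suc (toℕ i))) (g≡0 0 z<s λ ()))
        (∑-single n (g ∘ suc) a<n λ i i<n i≢a → g≡0 (suc i) (s<s i<n) (i≢a ∘ suc-injective))

∑-split : ∀ m n (g : ℕ → ℕ) →
      ∑[ i < m + n ] g (toℕ i) ≡ ∑[ i < m ] g (toℕ i) + ∑[ i < n ] g (m + toℕ i)
∑-split zero    n g = refl
∑-split (suc m) n g = trans (cong (g 0 +_) (∑-split m n (g ∘ suc))) (sym (+-assoc (g 0) _ _))

∑-≡ᵇ : ∀ n {y} → y < n → ∑[ j < n ] 𝟙 (y ≡ᵇ toℕ j) ≡ 1
∑-≡ᵇ n {y} y<n = trans (∑-single n (λ j → 𝟙 (y ≡ᵇ j)) y<n λ j _ j≢y → 𝟙-false (j≢y ∘ sym ∘ ≡ᵇ⇒≡ y j))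
                      (𝟙-true (≡⇒≡ᵇ y y refl))

∑-pointwise-+ : ∀ n (g h k : ℕ → ℕ) → (∀ i → g i ≡ h i + k i) →
                ∑[ i < n ] g (toℕ i) ≡ ∑[ i < n ] h (toℕ i) + ∑[ i < n ] k (toℕ i)
∑-pointwise-+ n g h k g≡h+k = trans (sum-cong-≗ {n} (g≡h+k ∘ toℕ)) (∑-distrib-+ {n} (h ∘ toℕ) (k ∘ toℕ))

∑-pred : ∀ n .{{_ : NonZero n}} (g : ℕ → ℕ) → ∑[ i < n ] g (toℕ i) ≡ g 0 + ∑[ i < n ∸ 1 ] g (suc (toℕ i))
∑-pred (suc n) g = refl

sum-applyUpTo : ∀ n (f g : ℕ → ℕ) → sum (List.map g (applyUpTo f n)) ≡ ∑[ i < n ] g (f (toℕ i))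
sum-applyUpTo zero    f g = refl
sum-applyUpTo (suc n) f g = cong (g (f 0) +_) (sum-applyUpTo n (f ∘ suc) g)

∑-multiples : ∀ q .{{_ : NonZero q}} n → ∑[ i < n * q ] 𝟙 ⌊ q ∣? toℕ i ⌋ ≡ n
∑-multiples q zero    = refl
∑-multiples q (suc n) = begin
  ∑[ i < q + n * q ] 𝟙 ⌊ q ∣? toℕ i ⌋
    ≡⟨ ∑-split q (n * q) (λ i → 𝟙 ⌊ q ∣? i ⌋) ⟩
  ∑[ i < q ] 𝟙 ⌊ q ∣? toℕ i ⌋ + ∑[ i < n * q ] 𝟙 ⌊ q ∣? q + toℕ i ⌋
    ≡⟨ cong₂ _+_ only-0 (sum-cong-≗ {n * q} λ i → cong 𝟙 (shift (toℕ i))) ⟩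
  1 + ∑[ i < n * q ] 𝟙 ⌊ q ∣? toℕ i ⌋
    ≡⟨ cong suc (∑-multiples q n) ⟩
  suc n ∎
  where
  open ≡-Reasoning
  only-0 : ∑[ i < q ] 𝟙 ⌊ q ∣? toℕ i ⌋ ≡ 1
  only-0 = trans (∑-single q (λ i → 𝟙 ⌊ q ∣? i ⌋) (>-nonZero⁻¹ q)
                   λ i i<q i≢0 → 𝟙-false λ t → >⇒∤ {{≢-nonZero i≢0}} i<q (toWitness t))
                 (𝟙-true (fromWitness (q ∣0)))
  shift : ∀ i → ⌊ q ∣? q + i ⌋ ≡ ⌊ q ∣? i ⌋
  shift i = ⌊⌋-cong (mk⇔ (λ q∣q+i → ∣m+n∣m⇒∣n q∣q+i ∣-refl) (∣m∣n⇒∣m+n ∣-refl)) (q ∣? q + i) (q ∣? i)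

-- Iterates and periodic points

module _ (f : ℕ → ℕ) where

  iter-+ : ∀ m n x → iter f (m + n) x ≡ iter f m (iter f n x)
  iter-+ zero    n x = refl
  iter-+ (suc m) n x = cong f (iter-+ m n x)

  iter-comm : ∀ m n x → iter f m (iter f n x) ≡ iter f n (iter f m x)
  iter-comm m n x = begin
    iter f m (iter f n x) ≡⟨ iter-+ m n x ⟨
    iter f (m + n) x      ≡⟨ cong (λ k → iter f k x) (+-comm m n) ⟩
    iter f (n + m) x      ≡⟨ iter-+ n m x ⟩
    iter f n (iter f m x) ∎
    where open ≡-Reasoning

  iter-< : ∀ {N} → (∀ y → y < N → f y < N) → ∀ m {x} → x < N → iter f m x < N
  iter-< f-< zero    x<N = x<N
  iter-< f-< (suc m) x<N = f-< _ (iter-< f-< m x<N)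

  HasPeriod : ℕ → ℕ → Set
  HasPeriod L x = ∀ m → iter f m x ≡ x ⇔ L ∣ m

  IsOrbitMin : ℕ → Set
  IsOrbitMin x = ∀ m → x ≤ iter f m x

  module _ {L x} .{{_ : NonZero L}} (period : HasPeriod L x) where

    private
      returns : ∀ {m} → L ∣ m → iter f m x ≡ x
      returns {m} = Equivalence.from (period m)

    iter-% : ∀ m → iter f m x ≡ iter f (m % L) x
    iter-% m = begin
      iter f m x                            ≡⟨ cong (λ n → iter f n x) (m≡m%n+[m/n]*n m L) ⟩
      iter f (m % L + m / L * L) x          ≡⟨ iter-+ (m % L) (m / L * L) x ⟩
      iter f (m % L) (iter f (m / L * L) x) ≡⟨ cong (iter f (m % L)) (returns (n∣m*n (m / L))) ⟩
      iter f (m % L) x                      ∎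
      where open ≡-Reasoning

    iter-inverse : ∀ m → iter f (m * pred L) (iter f m x) ≡ x
    iter-inverse m = begin
      iter f (m * pred L) (iter f m x) ≡⟨ iter-+ (m * pred L) m x ⟨
      iter f (m * pred L + m) x        ≡⟨ cong (λ n → iter f n x) m*pred[L]+m≡m*L ⟩
      iter f (m * L) x                 ≡⟨ returns (n∣m*n m) ⟩
      x                                ∎
      where
      open ≡-Reasoning
      m*pred[L]+m≡m*L : m * pred L + m ≡ m * L
      m*pred[L]+m≡m*L = trans (+-comm _ m) (trans (sym (*-suc m (pred L))) (cong (m *_) (suc-pred L)))

    private
      no-early-return : ∀ {a b} → a < b → b < L → iter f a x ≢ iter f b x
      no-early-return {a} {b} a<b b<L eq =
        >⇒∤ {{>-nonZero 0<d}} d<L (Equivalence.to (period d) returns-after-d)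
        where
        open ≡-Reasoning
        d = b ∸ a
        0<d : 0 < d
        0<d = m<n⇒0<n∸m a<b
        d<L : d < L
        d<L = ≤-<-trans (m∸n≤m b a) b<L
        back = iter f (a * pred L)
        returns-after-d : iter f d x ≡ x
        returns-after-d = begin
          iter f d x                    ≡⟨ cong (iter f d) (iter-inverse a) ⟨
          iter f d (back (iter f a x))  ≡⟨ iter-comm d (a * pred L) (iter f a x) ⟩
          back (iter f d (iter f a x))  ≡⟨ cong back (iter-+ d a x) ⟨
          back (iter f (d + a) x)       ≡⟨ cong (λ n → back (iter f n x)) (m∸n+n≡m (<⇒≤ a<b)) ⟩
          back (iter f b x)             ≡⟨ cong back eq ⟨
          back (iter f a x)             ≡⟨ iter-inverse a ⟩
          x                             ∎

    iter-injective : ∀ {a b} → a < L → b < L → iter f a x ≡ iter f b x → a ≡ b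
    iter-injective {a} {b} a<L b<L eq with <-cmp a b
    ... | tri≈ _ a≡b _ = a≡b
    ... | tri< a<b _ _ = contradiction eq (no-early-return a<b b<L)
    ... | tri> _ _ b<a = contradiction (sym eq) (no-early-return b<a a<L)

    orbitMin⇔bounded : ∀ {n} → L ≤ n → IsOrbitMin x ⇔ (∀ m → m < n → x ≤ iter f m x)
    orbitMin⇔bounded L≤n = mk⇔ (λ x-min m _ → x-min m) λ bounded m →
      subst (x ≤_) (sym (iter-% m)) (bounded (m % L) (<-≤-trans (m%n<n m L) L≤n))

    period≤ : ∀ {N} → (∀ y → y < N → f y < N) → x < N → L ≤ N
    period≤ {N} f-< x<N = ≮⇒≥ λ N<L →
      let i , j , i<j , same = pigeonhole N<L orbit in
      <⇒≢ i<j (iter-injective (toℕ<n i) (toℕ<n j)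
        (trans (sym (toℕ-fromℕ< _)) (trans (cong toℕ same) (toℕ-fromℕ< _))))
      where
      orbit : Fin L → Fin N
      orbit a = fromℕ< (iter-< f-< (toℕ a) x<N)

-- Counting the orbits in a class of points with a common period

module OrbitCounting
  (f : ℕ → ℕ) (N : ℕ) (f-< : ∀ y → y < N → f y < N)
  (C : ℕ → Bool) (C-f : ∀ y → C (f y) ≡ C y)
  (L : ℕ) .{{_ : NonZero L}} (period : ∀ x → x < N → T (C x) → HasPeriod f L x)
  (isMin : ℕ → Bool) (isMin⇔ : ∀ x → x < N → T (C x) → T (isMin x) ⇔ IsOrbitMin f x)
  where

  C-iter : ∀ m x → C (iter f m x) ≡ C x
  C-iter zero    x = refl
  C-iter (suc m) x = trans (C-f _) (C-iter m x)

  C-iterᵀ : ∀ m {x} → T (C x) → T (C (iter f m x))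
  C-iterᵀ m {x} = subst T (sym (C-iter m x))

  orbitMin-≤ : ∀ {x y a b} → IsOrbitMin f x → y < N → T (C y) → iter f a x ≡ iter f b y → x ≤ y
  orbitMin-≤ {x} {y} {a} {b} x-min y<N Cy same = subst (x ≤_) y-from-x (x-min (b * pred L + a))
    where
    y-from-x : iter f (b * pred L + a) x ≡ y
    y-from-x = trans (iter-+ f (b * pred L) a x)
                     (trans (cong (iter f (b * pred L)) same) (iter-inverse f (period y y<N Cy) b))

  orbitMin-unique : ∀ {x y a b} → x < N → T (C x) → IsOrbitMin f x → y < N → T (C y) → IsOrbitMin f y →
                    iter f a x ≡ iter f b y → x ≡ y
  orbitMin-unique {a = a} {b} x<N Cx x-min y<N Cy y-min same =
    ≤-antisym (orbitMin-≤ {a = a} {b} x-min y<N Cy same) (orbitMin-≤ {a = b} {a} y-min x<N Cx (sym same))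

  -- i is the least of f⁰ j, …, f^{L−1} j, and f^{m₀(L−1)} leads from i = f^{m₀} j back to j.
  orbitMin-exists : ∀ {j} → j < N → T (C j) →
    ∃[ i ] ∃[ m ] i < N × T (C i) × IsOrbitMin f i × m < L × iter f m i ≡ j
  orbitMin-exists {j} j<N Cj = i , (m₀ * pred L) % L , i<N , Ci , i-min , m%n<n _ L , i-to-j
    where
    m₀ = argmin (λ m → iter f m j) 0 (upTo L)
    i = iter f m₀ j
    i<N = iter-< f f-< m₀ j<N
    Ci = C-iterᵀ m₀ Cj
    least : ∀ {m} → m < L → i ≤ iter f m j
    least m<L = All.lookup (f[argmin]≤f[xs] {f = λ m → iter f m j} 0 (upTo L)) (∈-upTo⁺ m<L)
    i-min : IsOrbitMin f i
    i-min n = subst (i ≤_) (trans (sym (iter-% f (period j j<N Cj) (n + m₀))) (iter-+ f n m₀ j))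
                           (least (m%n<n (n + m₀) L))
    i-to-j : iter f ((m₀ * pred L) % L) i ≡ j
    i-to-j = trans (sym (iter-% f (period i i<N Ci) (m₀ * pred L))) (iter-inverse f (period j j<N Cj) m₀)

  fiber : ℕ → ℕ → ℕ → ℕ
  fiber j i m = 𝟙 ((C i ∧ isMin i) ∧ (iter f m i ≡ᵇ j))

  fiber-member : ∀ {j i m} → T ((C i ∧ isMin i) ∧ (iter f m i ≡ᵇ j)) →
                 T (C i) × T (isMin i) × iter f m i ≡ j
  fiber-member {j} {i} {m} t =
    let Ci∧min , hits = Equivalence.to T-∧ t in
    let Ci , min = Equivalence.to T-∧ Ci∧min in
    Ci , min , ≡ᵇ⇒≡ (iter f m i) j hits

  fiber-size : ∀ {j} → j < N → ∑[ i < N ] ∑[ m < L ] fiber j (toℕ i) (toℕ m) ≡ 𝟙 (C j)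
  fiber-size {j} j<N with C j in Cj
  ... | false = ∑-zero N (λ i → ∑[ m < L ] fiber j i (toℕ m)) λ i _ →
                  ∑-zero L (fiber j i) λ m _ → 𝟙-false λ t →
                    let Ci , _ , hits = fiber-member {m = m} t in
                    subst T (trans (sym (C-iter m i)) (trans (cong C hits) Cj)) Ci
  ... | true with orbitMin-exists j<N (subst T (sym Cj) tt)
  ...   | i , m , i<N , Ci , i-min , m<L , i-to-j =
    trans (∑-single N (λ i → ∑[ m < L ] fiber j i (toℕ m)) i<N other-i)
          (trans (∑-single L (fiber j i) m<L other-m) (𝟙-true hit))
    where
    hit : T ((C i ∧ isMin i) ∧ (iter f m i ≡ᵇ j))
    hit = Equivalence.from T-∧ (Equivalence.from T-∧ (Ci , Equivalence.from (isMin⇔ i i<N Ci) i-min) ,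
                                 ≡⇒≡ᵇ (iter f m i) j i-to-j)
    other-i : ∀ i′ → i′ < N → i′ ≢ i → ∑[ m < L ] fiber j i′ (toℕ m) ≡ 0
    other-i i′ i′<N i′≢i = ∑-zero L (fiber j i′) λ m′ _ → 𝟙-false λ t →
      let Ci′ , i′-min , hits = fiber-member {m = m′} t in
      i′≢i (orbitMin-unique {a = m′} {m} i′<N Ci′ (Equivalence.to (isMin⇔ i′ i′<N Ci′) i′-min) i<N Ci i-min
                            (trans hits (sym i-to-j)))
    other-m : ∀ m′ → m′ < L → m′ ≢ m → fiber j i m′ ≡ 0
    other-m m′ m′<L m′≢m = 𝟙-false λ t →
      let _ , _ , hits = fiber-member {m = m′} t in
      m′≢m (iter-injective f (period i i<N Ci) m′<L m<L (trans hits (sym i-to-j)))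

  orbit-size : ∀ b {i} → i < N → 𝟙 b * L ≡ ∑[ m < L ] ∑[ j < N ] 𝟙 (b ∧ (iter f (toℕ m) i ≡ᵇ toℕ j))
  orbit-size false i<N = sym (∑-zero L (λ _ → ∑[ j < N ] 0) λ _ _ → sum-replicate-zero N)
  orbit-size true  {i} i<N = trans (+-identityʳ L) (sym (trans
    (∑-cong< L (λ m → ∑[ j < N ] 𝟙 (iter f m i ≡ᵇ toℕ j)) (λ _ → 1) λ m _ → ∑-≡ᵇ N (iter-< f f-< m i<N))
    (∑-one L)))

  -- Double counting of the triples (i, m, j) with i ∈ C least in its orbit, m < L and fᵐ i = j:
  -- each such i lies in L of them, each j ∈ C in exactly one.
  orbit-count : (∑[ i < N ] 𝟙 (C (toℕ i) ∧ isMin (toℕ i))) * L ≡ ∑[ i < N ] 𝟙 (C (toℕ i))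
  orbit-count = begin
    (∑[ i < N ] 𝟙 (C (toℕ i) ∧ isMin (toℕ i))) * L
      ≡⟨ *-distribʳ-sum {N} L (λ i → 𝟙 (C (toℕ i) ∧ isMin (toℕ i))) ⟩
    ∑[ i < N ] (𝟙 (C (toℕ i) ∧ isMin (toℕ i)) * L)
      ≡⟨ sum-cong-≗ {N} (λ i → orbit-size (C (toℕ i) ∧ isMin (toℕ i)) (toℕ<n i)) ⟩
    ∑[ i < N ] ∑[ m < L ] ∑[ j < N ] fiber (toℕ j) (toℕ i) (toℕ m)
      ≡⟨ sum-cong-≗ {N} (λ i → ∑-comm {L} {N} (λ m j → fiber (toℕ j) (toℕ i) (toℕ m))) ⟩
    ∑[ i < N ] ∑[ j < N ] ∑[ m < L ] fiber (toℕ j) (toℕ i) (toℕ m)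
      ≡⟨ ∑-comm {N} {N} (λ i j → ∑[ m < L ] fiber (toℕ j) (toℕ i) (toℕ m)) ⟩
    ∑[ j < N ] ∑[ i < N ] ∑[ m < L ] fiber (toℕ j) (toℕ i) (toℕ m)
      ≡⟨ sum-cong-≗ {N} (λ j → fiber-size (toℕ<n j)) ⟩
    ∑[ j < N ] 𝟙 (C (toℕ j)) ∎
    where open ≡-Reasoning

-- Arithmetic modulo n

modN≡% : ∀ n .{{_ : NonZero n}} x → modN n x ≡ x % n
modN≡% (suc n) x = refl

[m*[n%o]]%o≡[m*n]%o : ∀ m n o .{{_ : NonZero o}} → m * (n % o) % o ≡ m * n % o
[m*[n%o]]%o≡[m*n]%o m n o = begin
  m * (n % o) % o           ≡⟨ %-distribˡ-* m (n % o) o ⟩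
  m % o * (n % o % o) % o   ≡⟨ cong (λ y → m % o * y % o) (m%n%n≡m%n n o) ⟩
  m % o * (n % o) % o       ≡⟨ %-distribˡ-* m n o ⟨
  m * n % o                 ∎
  where open ≡-Reasoning

m%o≡1⇒[m*n]%o≡n%o : ∀ {m} n {o} .{{_ : NonZero o}} → m % o ≡ 1 → m * n % o ≡ n % o
m%o≡1⇒[m*n]%o≡n%o {m} n {o} m≡1 = begin
  m * n % o             ≡⟨ %-distribˡ-* m n o ⟩
  m % o * (n % o) % o   ≡⟨ cong (λ y → y * (n % o) % o) m≡1 ⟩
  1 * (n % o) % o       ≡⟨ cong (_% o) (*-identityˡ (n % o)) ⟩
  n % o % o             ≡⟨ m%n%n≡m%n n o ⟩
  n % o                 ∎
  where open ≡-Reasoning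

[i+d]%n≡i⇔n∣d : ∀ {n} .{{_ : NonZero n}} {i} d → i < n → (i + d) % n ≡ i ⇔ n ∣ d
[i+d]%n≡i⇔n∣d {n} {i} d i<n = mk⇔
  (λ i+d≡i → divides ((i + d) / n)
    (+-cancelˡ-≡ i d _ (trans (m≡m%n+[m/n]*n (i + d) n) (cong (_+ (i + d) / n * n) i+d≡i))))
  (λ n∣d → trans (%-remove-+ʳ i n∣d) (m<n⇒m%n≡m i<n))

a%q≡1⇔q∣pred[a] : ∀ {q} .{{_ : NonZero q}} → 1 < q → ∀ a .{{_ : NonZero a}} → a % q ≡ 1 ⇔ q ∣ pred a
a%q≡1⇔q∣pred[a] {q} 1<q a = subst (λ b → b % q ≡ 1 ⇔ q ∣ pred a) (suc-pred a) ([i+d]%n≡i⇔n∣d (pred a) 1<q)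

module _ {q} .{{_ : NonZero q}} (1<q : 1 < q) {r k} (order : IsMultOrder q r k) where

  private
    instance
      k≢0 : NonZero k
      k≢0 = >-nonZero (proj₁ order)

    1%q≡1 : 1 % q ≡ 1
    1%q≡1 = m<n⇒m%n≡m 1<q

    r^k≡1 : r ^ k % q ≡ 1
    r^k≡1 = trans (sym (modN≡% q _)) (trans (proj₁ (proj₂ order)) (trans (modN≡% q 1) 1%q≡1))

    minimal : ∀ j → 0 < j → r ^ j % q ≡ 1 → k ≤ j
    minimal j 0<j r^j≡1 = proj₂ (proj₂ order) j 0<j
      (trans (modN≡% q _) (trans r^j≡1 (sym (trans (modN≡% q 1) 1%q≡1))))

    r^[c*k]≡1 : ∀ c → r ^ (c * k) % q ≡ 1
    r^[c*k]≡1 zero    = 1%q≡1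
    r^[c*k]≡1 (suc c) = begin
      r ^ (k + c * k) % q       ≡⟨ cong (_% q) (^-distribˡ-+-* r k (c * k)) ⟩
      r ^ k * r ^ (c * k) % q   ≡⟨ m%o≡1⇒[m*n]%o≡n%o (r ^ (c * k)) r^k≡1 ⟩
      r ^ (c * k) % q           ≡⟨ r^[c*k]≡1 c ⟩
      1                         ∎
      where open ≡-Reasoning

    r^[m%k]≡1 : ∀ m → r ^ m % q ≡ 1 → r ^ (m % k) % q ≡ 1
    r^[m%k]≡1 m r^m≡1 = begin
      r ^ (m % k) % q                       ≡⟨ m%o≡1⇒[m*n]%o≡n%o (r ^ (m % k)) (r^[c*k]≡1 (m / k)) ⟨
      r ^ (m / k * k) * r ^ (m % k) % q     ≡⟨ cong (_% q) (*-comm (r ^ (m / k * k)) (r ^ (m % k))) ⟩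
      r ^ (m % k) * r ^ (m / k * k) % q     ≡⟨ cong (_% q) (^-distribˡ-+-* r (m % k) (m / k * k)) ⟨
      r ^ (m % k + m / k * k) % q           ≡⟨ cong (λ e → r ^ e % q) (m≡m%n+[m/n]*n m k) ⟨
      r ^ m % q                             ≡⟨ r^m≡1 ⟩
      1                                     ∎
      where open ≡-Reasoning

  order-∣⇔ : ∀ m → r ^ m % q ≡ 1 ⇔ k ∣ m
  order-∣⇔ m = mk⇔ to from
    where
    to : r ^ m % q ≡ 1 → k ∣ m
    to r^m≡1 with m % k ≟ 0
    ... | yes m%k≡0 = m%n≡0⇒n∣m m k m%k≡0
    ... | no  m%k≢0 = contradiction (minimal (m % k) (n≢0⇒n>0 m%k≢0) (r^[m%k]≡1 m r^m≡1)) (<⇒≱ (m%n<n m k))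
    from : k ∣ m → r ^ m % q ≡ 1
    from (divides c refl) = r^[c*k]≡1 c

  order-∣pred⇔ : .{{_ : NonZero r}} → ∀ m → q ∣ pred (r ^ m) ⇔ k ∣ m
  order-∣pred⇔ m = order-∣⇔ m ⇔-∘ ⇔-sym (a%q≡1⇔q∣pred[a] 1<q (r ^ m) {{m^n≢0 r m}})

r%3≡1⇒ord₃≡1 : ∀ {r} → r % 3 ≡ 1 → IsMultOrder 3 r 1
r%3≡1⇒ord₃≡1 {r} r≡1 = z<s , trans (cong (_% 3) (*-identityʳ r)) r≡1 , λ _ 0<j _ → 0<j

r%3≡2⇒ord₃≡2 : ∀ {r} → r % 3 ≡ 2 → IsMultOrder 3 r 2
r%3≡2⇒ord₃≡2 {r} r≡2 = z<s , r²≡1 , minimal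
  where
  r≡r^1 : r ≡ r ^ 1
  r≡r^1 = sym (*-identityʳ r)
  r²≡1 : r ^ 2 % 3 ≡ 1
  r²≡1 = trans (cong (λ y → r * y % 3) (sym r≡r^1))
               (trans (%-distribˡ-* r r 3) (cong₂ (λ a b → a * b % 3) r≡2 r≡2))
  minimal : ∀ j → 0 < j → r ^ j % 3 ≡ 1 → 2 ≤ j
  minimal 1             _ r≡1 = contradiction (trans (sym r≡2) (trans (cong (_% 3) r≡r^1) r≡1)) λ ()
  minimal (suc (suc j)) _ _   = s≤s (s≤s z≤n)

prime∣*⇔ : ∀ {q} → Prime q → ∀ a b → q ∣ a * b ⇔ (q ∣ a ⊎ q ∣ b)
prime∣*⇔ q-prime a b = mk⇔ (euclidsLemma a b q-prime) [ ∣m⇒∣m*n b , ∣n⇒∣m*n a ]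

prime∣∧∣⇒*∣ : ∀ {q k m} → Prime q → ¬ q ∣ k → q ∣ m → k ∣ m → q * k ∣ m
prime∣∧∣⇒*∣ {q} {k} q-prime q∤k q∣ck (divides c refl) with euclidsLemma c k q-prime q∣ck
... | inj₁ (divides e refl) = divides e (*-assoc e q k)
... | inj₂ q∣k              = contradiction q∣k q∤k

∣⇒[∣∧∣⇔∣] : ∀ {ℓ k} → ℓ ∣ k → ∀ m → (ℓ ∣ m × k ∣ m) ⇔ k ∣ m
∣⇒[∣∧∣⇔∣] ℓ∣k m = mk⇔ proj₂ λ k∣m → ∣-trans ℓ∣k k∣m , k∣m

∤⇒[2∣∧∣⇔2*∣] : ∀ {k} → ¬ 2 ∣ k → ∀ m → (2 ∣ m × k ∣ m) ⇔ 2 * k ∣ m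
∤⇒[2∣∧∣⇔2*∣] {k} 2∤k m = mk⇔ (λ (2∣m , k∣m) → prime∣∧∣⇒*∣ prime[2] 2∤k 2∣m k∣m)
                                λ 2k∣m → m*n∣⇒m∣ 2 k 2k∣m , m*n∣⇒n∣ 2 k 2k∣m

%2≡1⇒2∤ : ∀ {k} → k % 2 ≡ 1 → ¬ 2 ∣ k
%2≡1⇒2∤ {k} k-odd 2∣k = 0≢1+n (trans (sym (n∣m⇒m%n≡0 k 2 2∣k)) k-odd)

coprime⇒∤ : ∀ {r n q} → Coprime r n → q ∣ n → 1 < q → ¬ q ∣ r
coprime⇒∤ r⊥n q∣n 1<q q∣r = <⇒≢ 1<q (sym (r⊥n (q∣r , q∣n)))

cycle-sum : ∀ a c₁ c₂ c₃ {k P} .{{_ : NonZero k}} →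
            c₁ * k ≡ P → c₃ * k ≡ a * P → c₁ + c₂ + c₃ ≡ c₂ + suc a * P / k
cycle-sum a c₁ c₂ c₃ {k} {P} c₁k≡P c₃k≡aP = begin
  c₁ + c₂ + c₃             ≡⟨ cong (c₁ + c₂ +_) c₃≡ac₁ ⟩
  c₁ + c₂ + a * c₁         ≡⟨ rearrange c₁ c₂ a ⟩
  c₂ + suc a * c₁          ≡⟨ cong (c₂ +_) (m*n/n≡m (suc a * c₁) k) ⟨
  c₂ + suc a * c₁ * k / k  ≡⟨ cong (λ n → c₂ + n / k) (trans (*-assoc (suc a) c₁ k) (cong (suc a *_) c₁k≡P)) ⟩
  c₂ + suc a * P / k       ∎
  where
  open ≡-Reasoning
  c₃≡ac₁ : c₃ ≡ a * c₁
  c₃≡ac₁ = *-cancelʳ-≡ c₃ (a * c₁) k (trans c₃k≡aP (trans (cong (a *_) (sym c₁k≡P)) (sym (*-assoc a c₁ k))))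
  rearrange : ∀ x y z → x + y + z * x ≡ y + suc z * x
  rearrange = solve-∀

aExp-< : ∀ n .{{_ : NonZero n}} r x → aExp n r x < n
aExp-< (suc n) r x = m%n<n (r * x) (suc n)

iter-aExp : ∀ n .{{_ : NonZero n}} r m {x} → x < n → iter (aExp n r) m x ≡ r ^ m * x % n
iter-aExp n r zero    {x} x<n = sym (trans (cong (_% n) (*-identityˡ x)) (m<n⇒m%n≡m x<n))
iter-aExp n r (suc m) {x} x<n = begin
  aExp n r (iter (aExp n r) m x) ≡⟨ modN≡% n _ ⟩
  r * iter (aExp n r) m x % n    ≡⟨ cong (λ y → r * y % n) (iter-aExp n r m x<n) ⟩
  r * (r ^ m * x % n) % n        ≡⟨ [m*[n%o]]%o≡[m*n]%o r (r ^ m * x) n ⟩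
  r * (r ^ m * x) % n            ≡⟨ cong (_% n) (*-assoc r (r ^ m) x) ⟨
  r ^ suc m * x % n              ∎
  where open ≡-Reasoning

aExp-fixed⇔ : ∀ n .{{_ : NonZero n}} r .{{_ : NonZero r}} m {x} → x < n →
              iter (aExp n r) m x ≡ x ⇔ n ∣ pred (r ^ m) * x
aExp-fixed⇔ n r m {x} x<n =
  subst (λ y → y ≡ x ⇔ n ∣ pred (r ^ m) * x) (sym iter≡) ([i+d]%n≡i⇔n∣d (pred (r ^ m) * x) x<n)
  where
  iter≡ : iter (aExp n r) m x ≡ (x + pred (r ^ m) * x) % n
  iter≡ = trans (iter-aExp n r m x<n) (cong (λ y → y * x % n) (sym (suc-pred (r ^ m) {{m^n≢0 r m}})))

aExp-∣⇔ : ∀ n .{{_ : NonZero n}} r {q} → Prime q → q ∣ n → ¬ q ∣ r → ∀ x → q ∣ aExp n r x ⇔ q ∣ x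
aExp-∣⇔ n r {q} q-prime q∣n q∤r x = subst (λ y → q ∣ y ⇔ q ∣ x) (sym (modN≡% n (r * x))) (mk⇔
  (λ q∣rx%n → [ (λ q∣r → contradiction q∣r q∤r) , id ]′ (euclidsLemma r x q-prime (∣n∣m%n⇒∣m q∣n q∣rx%n)))
  (λ q∣x → %-presˡ-∣ (∣n⇒∣m*n r q∣x) q∣n))

isCycleRep⇔ : ∀ n r x → T (isCycleRep n r x) ⇔ (∀ m → m < n → x ≤ iter (aExp n r) m x)
isCycleRep⇔ n r x = mk⇔
  (λ t m m<n → ≤ᵇ⇒≤ x _ (All.lookup (map⁻ (map⁻ (Equivalence.to (T-and _) t))) (∈-upTo⁺ m<n)))
  (λ bounded → Equivalence.from (T-and _)
    (map⁺ (map⁺ (All.tabulate λ m∈ → ≤⇒≤ᵇ (bounded _ (∈-upTo⁻ m∈))))))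

cU≡∑ : ∀ n r → cU n r ≡ ∑[ i < n ∸ 1 ] 𝟙 (isCycleRep n r (suc (toℕ i)))
cU≡∑ n r = trans (cong (λ xs → sum (List.map (λ i → 𝟙 (isCycleRep n r i)) xs)) (map-applyUpTo id suc (n ∸ 1)))
                 (sum-applyUpTo (n ∸ 1) suc (λ i → 𝟙 (isCycleRep n r i)))

cycles*period≡size : ∀ n .{{_ : NonZero n}} r (C : ℕ → Bool) → (∀ y → C (aExp n r y) ≡ C y) →
  ∀ L .{{_ : NonZero L}} → (∀ x → x < n → T (C x) → HasPeriod (aExp n r) L x) →
  (∑[ i < n ] 𝟙 (C (toℕ i) ∧ isCycleRep n r (toℕ i))) * L ≡ ∑[ i < n ] 𝟙 (C (toℕ i))
cycles*period≡size n r C C-aExp L period =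
  OrbitCounting.orbit-count (aExp n r) n (λ y _ → aExp-< n r y) C C-aExp L period (isCycleRep n r)
    λ x x<n Cx → let period-x = period x x<n Cx in
      ⇔-sym (orbitMin⇔bounded (aExp n r) period-x (period≤ (aExp n r) period-x (λ y _ → aExp-< n r y) x<n))
        ⇔-∘ isCycleRep⇔ n r x

-- Multiplication by r modulo 3p

module MultiplicationMod3p (p : ℕ) (p-prime : Prime p) (3<p : 3 < p)
                           (r : ℕ) .{{_ : NonZero r}} (3∤r : ¬ 3 ∣ r) (p∤r : ¬ p ∣ r) where

  private
    instance
      p≢0 : NonZero p
      p≢0 = prime⇒nonZero p-prime
      3p≢0 : NonZero (3 * p)
      3p≢0 = m*n≢0 3 p

    3-prime : Prime 3
    3-prime = from-yes (prime? 3)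

    a : ℕ → ℕ
    a = aExp (3 * p) r

  div3 divp div3p : ℕ → Bool
  div3  i = ⌊ 3 ∣? i ⌋
  divp  i = ⌊ p ∣? i ⌋
  div3p i = div3 i ∧ divp i

  ofOrderP ofOrder3 ofOrder3p : ℕ → Bool
  ofOrderP  i = div3 i ∧ not (divp i)
  ofOrder3  i = not (div3 i) ∧ divp i
  ofOrder3p i = not (div3 i) ∧ not (divp i)

  size cycles : (ℕ → Bool) → ℕ
  size   C = ∑[ i < 3 * p ] 𝟙 (C (toℕ i))
  cycles C = ∑[ i < 3 * p ] 𝟙 (C (toℕ i) ∧ isCycleRep (3 * p) r (toℕ i))

  div3-a : ∀ y → div3 (a y) ≡ div3 y
  div3-a y = ⌊⌋-cong (aExp-∣⇔ (3 * p) r 3-prime (m∣m*n p) 3∤r y) _ _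

  divp-a : ∀ y → divp (a y) ≡ divp y
  divp-a y = ⌊⌋-cong (aExp-∣⇔ (3 * p) r p-prime (n∣m*n 3) p∤r y) _ _

  3p∣⇔ : ∀ y → 3 * p ∣ y ⇔ (3 ∣ y × p ∣ y)
  3p∣⇔ y = mk⇔ (λ 3p∣y → m*n∣⇒m∣ 3 p 3p∣y , m*n∣⇒n∣ 3 p 3p∣y)
               λ (3∣y , p∣y) → subst (_∣ y) (*-comm p 3) (prime∣∧∣⇒*∣ p-prime (>⇒∤ 3<p) p∣y 3∣y)

  div3p⇔ : ∀ x → T (div3p x) ⇔ 3 * p ∣ x
  div3p⇔ x = ⇔-sym (3p∣⇔ x) ⇔-∘ ((T⌊⌋⇔ (3 ∣? x) ×-⇔ T⌊⌋⇔ (p ∣? x)) ⇔-∘ T-∧)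

  div3p⇒≡0 : ∀ {x} → x < 3 * p → T (div3p x) → x ≡ 0
  div3p⇒≡0 {zero}  _   _ = refl
  div3p⇒≡0 {suc x} x<N t = contradiction (∣⇒≤ (Equivalence.to (div3p⇔ (suc x)) t)) (<⇒≱ x<N)

  div3p[0] : T (div3p 0)
  div3p[0] = Equivalence.from (div3p⇔ 0) ((3 * p) ∣0)

  size-div3p : size div3p ≡ 1
  size-div3p = trans (∑-single (3 * p) (λ i → 𝟙 (div3 i ∧ divp i)) (>-nonZero⁻¹ (3 * p))
                       λ i i<N i≢0 → 𝟙-false (i≢0 ∘ div3p⇒≡0 i<N))
                    (𝟙-true div3p[0])

  size-div3 : size div3 ≡ p
  size-div3 = subst (λ n → ∑[ i < n ] 𝟙 (div3 (toℕ i)) ≡ p) (*-comm p 3) (∑-multiples 3 p)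

  size-divp : size divp ≡ 3
  size-divp = ∑-multiples p 3

  size-split : ∀ C D E → (∀ i → 𝟙 (C i) ≡ 𝟙 (D i) + 𝟙 (E i)) → size C ≡ size D + size E
  size-split C D E = ∑-pointwise-+ (3 * p) (𝟙 ∘ C) (𝟙 ∘ D) (𝟙 ∘ E)

  size-P : size ofOrderP ≡ p ∸ 1
  size-P = trans (sym (m+n∸n≡m (size ofOrderP) 1)) (cong (_∸ 1) (begin
    size ofOrderP + 1            ≡⟨ cong (size ofOrderP +_) size-div3p ⟨
    size ofOrderP + size div3p   ≡⟨ size-split div3 ofOrderP div3p (λ i → 𝟙-split (div3 i) (divp i)) ⟨
    size div3                    ≡⟨ size-div3 ⟩
    p                            ∎))
    where open ≡-Reasoning

  size-3 : size ofOrder3 ≡ 2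
  size-3 = +-cancelʳ-≡ 1 (size ofOrder3) 2 (begin
    size ofOrder3 + 1            ≡⟨ cong (size ofOrder3 +_) size-div3p ⟨
    size ofOrder3 + size div3p   ≡⟨ size-split divp ofOrder3 div3p (λ i → 𝟙-splitʳ (div3 i) (divp i)) ⟨
    size divp                    ≡⟨ size-divp ⟩
    3                            ∎)
    where open ≡-Reasoning

  size-3p : size ofOrder3p ≡ 2 * (p ∸ 1)
  size-3p = +-cancelʳ-≡ 2 _ _ (+-cancelˡ-≡ p _ _ (begin
    p + (size ofOrder3p + 2)                ≡⟨ cong (λ s → p + (size ofOrder3p + s)) size-3 ⟨
    p + (size ofOrder3p + size ofOrder3)    ≡⟨ cong₂ _+_ size-div3 (size-split (not ∘ div3) ofOrder3p ofOrder3
                                                    λ i → 𝟙-split (not (div3 i)) (divp i)) ⟨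
    size div3 + size (not ∘ div3)           ≡⟨ size-split (λ _ → true) div3 (not ∘ div3) (𝟙-not ∘ div3) ⟨
    size (λ _ → true)                       ≡⟨ ∑-one (3 * p) ⟩
    3 * p                                   ≡⟨ cong (3 *_) p≡q+1 ⟩
    3 * (p ∸ 1 + 1)                         ≡⟨ 3[q+1]≡q+1+[2q+2] (p ∸ 1) ⟩
    p ∸ 1 + 1 + (2 * (p ∸ 1) + 2)           ≡⟨ cong (_+ (2 * (p ∸ 1) + 2)) p≡q+1 ⟨
    p + (2 * (p ∸ 1) + 2)                   ∎))
    where
    open ≡-Reasoning
    p≡q+1 : p ≡ p ∸ 1 + 1
    p≡q+1 = sym (m∸n+n≡m (>-nonZero⁻¹ p))
    3[q+1]≡q+1+[2q+2] : ∀ q → 3 * (q + 1) ≡ q + 1 + (2 * q + 2)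
    3[q+1]≡q+1+[2q+2] = solve-∀

  cU≡cycles : cU (3 * p) r ≡ cycles ofOrderP + cycles ofOrder3 + cycles ofOrder3p
  cU≡cycles = begin
    cU (3 * p) r
      ≡⟨ cU≡∑ (3 * p) r ⟩
    ∑[ i < 3 * p ∸ 1 ] 𝟙 (rep (suc (toℕ i)))
      ≡⟨ ∑-cong< (3 * p ∸ 1) (G ∘ suc) (𝟙 ∘ rep ∘ suc) G[1+i]≡ ⟨
    ∑[ i < 3 * p ∸ 1 ] G (suc (toℕ i))
      ≡⟨ cong (_+ ∑[ i < 3 * p ∸ 1 ] G (suc (toℕ i))) (𝟙-not-true (rep 0) div3p[0]) ⟨
    G 0 + ∑[ i < 3 * p ∸ 1 ] G (suc (toℕ i))
      ≡⟨ ∑-pred (3 * p) G ⟨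
    ∑[ i < 3 * p ] G (toℕ i)
      ≡⟨ ∑-pointwise-+ (3 * p) G (λ i → h ofOrderP i + h ofOrder3 i) (h ofOrder3p)
                       (λ i → 𝟙-cover (div3 i) (divp i) (rep i)) ⟩
    ∑[ i < 3 * p ] (h ofOrderP (toℕ i) + h ofOrder3 (toℕ i)) + cycles ofOrder3p
      ≡⟨ cong (_+ cycles ofOrder3p) (∑-pointwise-+ (3 * p) _ (h ofOrderP) (h ofOrder3) λ _ → refl) ⟩
    cycles ofOrderP + cycles ofOrder3 + cycles ofOrder3p ∎
    where
    open ≡-Reasoning
    rep : ℕ → Bool
    rep = isCycleRep (3 * p) r
    G : ℕ → ℕ
    G i = 𝟙 (not (div3p i) ∧ rep i)
    h : (ℕ → Bool) → ℕ → ℕ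
    h C i = 𝟙 (C i ∧ rep i)
    G[1+i]≡ : ∀ i → i < 3 * p ∸ 1 → G (suc i) ≡ 𝟙 (rep (suc i))
    G[1+i]≡ i i<N∸1 = 𝟙-not-false (rep (suc i)) λ div3p[1+i] →
      1+n≢0 (div3p⇒≡0 (subst (suc i <_) (m+[n∸m]≡n (>-nonZero⁻¹ (3 * p))) (s<s i<N∸1)) div3p[1+i])

  ofOrderP-a : ∀ y → ofOrderP (a y) ≡ ofOrderP y
  ofOrderP-a y = cong₂ (λ b c → b ∧ not c) (div3-a y) (divp-a y)

  ofOrder3-a : ∀ y → ofOrder3 (a y) ≡ ofOrder3 y
  ofOrder3-a y = cong₂ (λ b c → not b ∧ c) (div3-a y) (divp-a y)

  ofOrder3p-a : ∀ y → ofOrder3p (a y) ≡ ofOrder3p y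
  ofOrder3p-a y = cong₂ (λ b c → not b ∧ not c) (div3-a y) (divp-a y)

  ofOrderP⇒ : ∀ {x} → T (ofOrderP x) → 3 ∣ x × ¬ p ∣ x
  ofOrderP⇒ {x} = Equivalence.to ((T⌊⌋⇔ (3 ∣? x) ×-⇔ T-not⌊⌋⇔ (p ∣? x)) ⇔-∘ T-∧)

  ofOrder3⇒ : ∀ {x} → T (ofOrder3 x) → ¬ 3 ∣ x × p ∣ x
  ofOrder3⇒ {x} = Equivalence.to ((T-not⌊⌋⇔ (3 ∣? x) ×-⇔ T⌊⌋⇔ (p ∣? x)) ⇔-∘ T-∧)

  ofOrder3p⇒ : ∀ {x} → T (ofOrder3p x) → ¬ 3 ∣ x × ¬ p ∣ x
  ofOrder3p⇒ {x} = Equivalence.to ((T-not⌊⌋⇔ (3 ∣? x) ×-⇔ T-not⌊⌋⇔ (p ∣? x)) ⇔-∘ T-∧)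

  module Orders {ℓ k} (order₃ : IsMultOrder 3 r ℓ) (orderₚ : IsMultOrder p r k) where

    private
      instance
        ℓ≢0 : NonZero ℓ
        ℓ≢0 = >-nonZero (proj₁ order₃)
        k≢0 : NonZero k
        k≢0 = >-nonZero (proj₁ orderₚ)

    a-fixed⇔ : ∀ m {x} → x < 3 * p → iter a m x ≡ x ⇔ ((ℓ ∣ m ⊎ 3 ∣ x) × (k ∣ m ⊎ p ∣ x))
    a-fixed⇔ m x<N =
      ((order-∣pred⇔ (s≤s (s≤s z≤n)) order₃ m ⊎-⇔ ⇔-id _) ×-⇔ (order-∣pred⇔ 1<p orderₚ m ⊎-⇔ ⇔-id _))
      ⇔-∘ ((prime∣*⇔ 3-prime _ _ ×-⇔ prime∣*⇔ p-prime _ _) ⇔-∘ (3p∣⇔ _ ⇔-∘ aExp-fixed⇔ (3 * p) r m x<N))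
      where
      1<p : 1 < p
      1<p = <-trans (s≤s (s≤s z≤n)) 3<p

    period-P : ∀ x → x < 3 * p → T (ofOrderP x) → HasPeriod a k x
    period-P x x<N t m with ofOrderP⇒ t
    ... | 3∣x , p∤x = mk⇔
      (λ fixed → [ id , (λ p∣x → contradiction p∣x p∤x) ]′ (proj₂ (Equivalence.to (a-fixed⇔ m x<N) fixed)))
      (λ k∣m → Equivalence.from (a-fixed⇔ m x<N) (inj₂ 3∣x , inj₁ k∣m))

    period-3 : ∀ x → x < 3 * p → T (ofOrder3 x) → HasPeriod a ℓ x
    period-3 x x<N t m with ofOrder3⇒ t
    ... | 3∤x , p∣x = mk⇔
      (λ fixed → [ id , (λ 3∣x → contradiction 3∣x 3∤x) ]′ (proj₁ (Equivalence.to (a-fixed⇔ m x<N) fixed)))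
      (λ ℓ∣m → Equivalence.from (a-fixed⇔ m x<N) (inj₁ ℓ∣m , inj₂ p∣x))

    period-3p : ∀ {L} → (∀ m → (ℓ ∣ m × k ∣ m) ⇔ L ∣ m) →
                ∀ x → x < 3 * p → T (ofOrder3p x) → HasPeriod a L x
    period-3p lcm x x<N t m with ofOrder3p⇒ t
    ... | 3∤x , p∤x = mk⇔
      (λ fixed → let ℓ∣m⊎3∣x , k∣m⊎p∣x = Equivalence.to (a-fixed⇔ m x<N) fixed in
        Equivalence.to (lcm m) ( [ id , (λ 3∣x → contradiction 3∣x 3∤x) ]′ ℓ∣m⊎3∣x
                               , [ id , (λ p∣x → contradiction p∣x p∤x) ]′ k∣m⊎p∣x))
      (λ L∣m → let ℓ∣m , k∣m = Equivalence.from (lcm m) L∣m in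
        Equivalence.from (a-fixed⇔ m x<N) (inj₁ ℓ∣m , inj₁ k∣m))

    cycles-P : cycles ofOrderP * k ≡ p ∸ 1
    cycles-P = trans (cycles*period≡size (3 * p) r ofOrderP ofOrderP-a k period-P) size-P

    cycles-3 : cycles ofOrder3 * ℓ ≡ 2
    cycles-3 = trans (cycles*period≡size (3 * p) r ofOrder3 ofOrder3-a ℓ period-3) size-3

    cycles-3p : ∀ L .{{_ : NonZero L}} → (∀ m → (ℓ ∣ m × k ∣ m) ⇔ L ∣ m) → cycles ofOrder3p * L ≡ 2 * (p ∸ 1)
    cycles-3p L lcm = trans (cycles*period≡size (3 * p) r ofOrder3p ofOrder3p-a L (period-3p lcm)) size-3p

    cU≡formula : ∀ a {c} → cycles ofOrder3p * k ≡ a * (p ∸ 1) → cycles ofOrder3 ≡ c →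
                 cU (3 * p) r ≡ c + suc a * (p ∸ 1) / k
    cU≡formula a c₃k≡ c₂≡c = trans cU≡cycles (trans
      (cycle-sum a (cycles ofOrderP) (cycles ofOrder3) (cycles ofOrder3p) cycles-P c₃k≡) (cong (_+ _) c₂≡c))

lemma5p1 : (p : ℕ) → Prime p → 3 < p →
    (t : ℕ) → (t ≡ 1 ⊎ t ≡ 3 ⊎ t ≡ p ⊎ t ≡ 3 * p) →
    (r : ℕ) → 1 ≤ r → r ≤ 3 * p ∸ 1 → Coprime r (3 * p) →
    (k : ℕ) → .{{_ : NonZero k}} → IsMultOrder p r k →
      (r % 3 ≡ 1 → cU (3 * p) r ≡ 2 + (3 * (p ∸ 1)) / k)
      × (r % 3 ≡ 2 → k % 2 ≡ 1 → cU (3 * p) r ≡ 1 + (2 * (p ∸ 1)) / k)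
      × (r % 3 ≡ 2 → k % 2 ≡ 0 → cU (3 * p) r ≡ 1 + (3 * (p ∸ 1)) / k)
lemma5p1 p p-prime 3<p _ _ r 1≤r _ r⊥3p k orderₚ =
    (λ r≡1 → let open Orders (r%3≡1⇒ord₃≡1 r≡1) orderₚ in
      cU≡formula 2 (cycles-3p k (∣⇒[∣∧∣⇔∣] (1∣ k))) (trans (sym (*-identityʳ _)) cycles-3))
  , (λ r≡2 k-odd → let open Orders (r%3≡2⇒ord₃≡2 r≡2) orderₚ in
      cU≡formula 1 (halve (cycles ofOrder3p) (cycles-3p (2 * k) {{m*n≢0 2 k}} (∤⇒[2∣∧∣⇔2*∣] (%2≡1⇒2∤ k-odd))))
                   (*-cancelʳ-≡ _ 1 2 cycles-3))
  , (λ r≡2 k-even → let open Orders (r%3≡2⇒ord₃≡2 r≡2) orderₚ in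
      cU≡formula 2 (cycles-3p k (∣⇒[∣∧∣⇔∣] (m%n≡0⇒n∣m k 2 k-even))) (*-cancelʳ-≡ _ 1 2 cycles-3))
  where
  open MultiplicationMod3p p p-prime 3<p r {{>-nonZero 1≤r}}
    (coprime⇒∤ r⊥3p (m∣m*n p) (s≤s (s≤s z≤n))) (coprime⇒∤ r⊥3p (n∣m*n 3) (<-trans (s≤s (s≤s z≤n)) 3<p))
  halve : ∀ c → c * (2 * k) ≡ 2 * (p ∸ 1) → c * k ≡ 1 * (p ∸ 1)
  halve c c[2k]≡ = *-cancelˡ-≡ (c * k) (1 * (p ∸ 1)) 2 (begin
    2 * (c * k)         ≡⟨ 2[ck]≡c[2k] c k ⟩
    c * (2 * k)         ≡⟨ c[2k]≡ ⟩
    2 * (p ∸ 1)         ≡⟨ cong (2 *_) (*-identityˡ (p ∸ 1)) ⟨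
    2 * (1 * (p ∸ 1))   ∎)
    where
    open ≡-Reasoning
    2[ck]≡c[2k] : ∀ c k → 2 * (c * k) ≡ c * (2 * k)
    2[ck]≡c[2k] = solve-∀
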